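{- Let $G$ be a finite, simple, connected graph on $n$ vertices and let $S=(G,\sigma)$ be a parity signed graph. If $S$ is degree-balanced, then $G$ is $K_{1,n-1}$ or $K_n$ when $n$ is even, and $G$ is $P_2\vee I_{n-2}$ or $K_n$ when $n$ is odd.
   Context: A signed graph $(G,\sigma)$ is a graph with $\sigma:E(G)\to\{1,-1\}$; edges with sign $-1$ are negative, others positive. $(G,\sigma)$ is a parity signed graph if $V(G)$ can be partitioned into two sets $V_1,V_2$ (parity sets) with $||V_1|-|V_2||\le1$ such that any two adjacent vertices lie in the same set iff the edge joining them is positive. For a vertex $v$, $d^-(v)$ and $d^+(v)$ are the numbers of negative and positive edges at $v$, and $d^\Delta(v)=d^-(v)-d^+(v)$. $S$ is degree-balanced (with respect to parity sets $V_1,V_2$) if for all $u\in V_1$, $v\in V_2$: $d^\Delta(u)+d^\Delta(v)=2$ when $uv\in E(G)$ and $d^\Delta(u)+d^\Delta(v)=0$ when $uv\notin E(G)$. $P_n$, $I_n$, $K_n$ denote the path, edgeless graph and complete graph on $n$ vertices, and $G\vee K$ is the join (disjoint union plus all edges between the two graphs). -}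

module Defs where

open import Data.Nat using (ℕ; zero; suc; _≡ᵇ_; _<ᵇ_; _≤_)
open import Data.Bool using (Bool; true; false; not; _∧_; _∨_; _xor_; _≟_)
open import Data.Fin using (Fin; toℕ)
open import Data.List using (List; filter; length; allFin; map)

open import Data.Integer using (ℤ; +_; _-_; _+_)
open import Data.Product using (Σ; _×_)
open import Function.Bundles using (_↔_; Inverse)
open import Relation.Binary.PropositionalEquality using (_≡_)
open import Relation.Nullary using (¬_)
open import Data.Empty using (⊥)

record Graph (n : ℕ) : Set where
  field
    adj   : Fin n → Fin n → Bool
    sym   : ∀ u v → adj u v ≡ adj v u
    irref : ∀ v → adj v v ≡ false
open Graph public

data Reach {n : ℕ} (G : Graph n) : Fin n → Fin n → Set where
  here : ∀ {u} → Reach G u u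
  step : ∀ {u v w} → adj G u v ≡ true → Reach G v w → Reach G u w

Connected : ∀ {n} → Graph n → Set
Connected {n} G = ∀ (u v : Fin n) → Reach G u v

data Sign : Set where
  pos neg : Sign

isNeg : Sign → Bool
isNeg pos = false
isNeg neg = true

isPos : Sign → Bool
isPos s = not (isNeg s)

-- A signature on G: a sign for every (unordered) edge; we take a function on
-- ordered pairs that is symmetric on edges (values on non-edges are irrelevant).
Signature : ∀ {n} → Graph n → Set
Signature {n} G = Σ (Fin n → Fin n → Sign)
  (λ σ → ∀ u v → adj G u v ≡ true → σ u v ≡ σ v u)

countV : ∀ {n} → (Fin n → Bool) → ℕ
countV {n} p = length (filter (λ v → p v ≟ true) (allFin n))


degNeg : ∀ {n} (G : Graph n) → (Fin n → Fin n → Sign) → Fin n → ℕ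
degNeg G σ v = countV (λ u → adj G v u ∧ isNeg (σ v u))

degPos : ∀ {n} (G : Graph n) → (Fin n → Fin n → Sign) → Fin n → ℕ
degPos G σ v = countV (λ u → adj G v u ∧ isPos (σ v u))

degΔ : ∀ {n} (G : Graph n) → (Fin n → Fin n → Sign) → Fin n → ℤ
degΔ G σ v = (+ degNeg G σ v) - (+ degPos G σ v)

-- Parity sets: part v ≡ true means v ∈ V₁, false means v ∈ V₂.
-- (G,σ) is parity signed w.r.t. part: ||V₁|-|V₂|| ≤ 1 and adjacent vertices
-- lie in the same set iff the edge is positive.
IsParityPartition : ∀ {n} (G : Graph n) → (Fin n → Fin n → Sign) → (Fin n → Bool) → Set
IsParityPartition G σ part =
  (countV part ≤ suc (countV (λ v → not (part v))) ×
   countV (λ v → not (part v)) ≤ suc (countV part)) ×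
  (∀ u v → adj G u v ≡ true → (part u ≡ part v → σ u v ≡ pos) × (σ u v ≡ pos → part u ≡ part v))

DegreeBalanced : ∀ {n} (G : Graph n) → (Fin n → Fin n → Sign) → (Fin n → Bool) → Set
DegreeBalanced {n} G σ part =
  ∀ (u v : Fin n) → part u ≡ true → part v ≡ false →
    (adj G u v ≡ true → degΔ G σ u + degΔ G σ v ≡ + 2) ×
    (adj G u v ≡ false → degΔ G σ u + degΔ G σ v ≡ + 0)

completeAdj : ∀ {n} → Fin n → Fin n → Bool
completeAdj u v = not (toℕ u ≡ᵇ toℕ v)

starAdj : ∀ {n} → Fin n → Fin n → Bool
starAdj u v = (toℕ u ≡ᵇ 0) xor (toℕ v ≡ᵇ 0)

p2JoinIAdj : ∀ {n} → Fin n → Fin n → Bool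
p2JoinIAdj u v = not (toℕ u ≡ᵇ toℕ v) ∧ ((toℕ u <ᵇ 2) ∨ (toℕ v <ᵇ 2))

IsoTo : ∀ {n} → Graph n → (Fin n → Fin n → Bool) → Set
IsoTo {n} G H = Σ (Fin n ↔ Fin n) λ f →
  ∀ u v → adj G u v ≡ H (Inverse.to f u) (Inverse.to f v)

-- Call V₁, V₂ the parity sets. The negative edges are exactly the edges between
-- V₁ and V₂, so d⁻ and d⁺ depend only on the partition, and adding the balance
-- conditions along the two diagonals of any u, u' ∈ V₁, v, v' ∈ V₂ gives
-- [uv] + [u'v'] = [uv'] + [u'v]. Hence, after possibly exchanging V₁ and V₂,
-- every vertex of V₁ is adjacent to all of V₂ (a hub) or to none of it.
-- If all of V₁ are hubs, balance together with d⁺ < |V₁|, |V₂| forces G = Kₙ.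
-- Otherwise take a non-hub z: connectivity gives a hub y and a neighbour of z in
-- V₁, and comparing the balance at (y, v) and at (z, v) gives
-- d⁺(y) + 2 = d⁺(z) + |V₂|, so d⁺(z) ∈ {1, 2}. If d⁺(z) = 2, or d⁺(z) = 1 and
-- |V₁| = |V₂|, every hub is adjacent to all other vertices. Then the hubs lie in
-- N(z) ∩ V₁, and the balance |hubs| = d⁺(z) + d⁺(v) at (z, v) forces d⁺(v) = 0
-- and N(z) ∩ V₁ = hubs: the non-hubs are independent and there are d⁺(z) hubs,
-- giving P₂ ∨ Iₙ₋₂ resp. K₁,ₙ₋₁. The last case d⁺(z) = 1, |V₁| = |V₂| + 1 is
-- excluded by parity: the sums of d⁺ over V₁ and over V₂ are both even, but they
-- add up to an odd number.

module Submission where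

open import Data.Bool using (Bool; true; false; not; _∧_; _∨_; _xor_)
open import Data.Bool.Properties
  using (∧-identityʳ; ∧-zeroʳ; ∨-identityʳ; xor-same; not-involutive; not-injective)
  renaming (_≟_ to _≟ᴮ_)
open import Data.Empty using (⊥; ⊥-elim)
open import Data.Fin using (Fin; zero; suc; toℕ)
open import Data.Fin.Permutation using (Permutation′; _⟨$⟩ʳ_; id; transpose; _∘ₚ_)
open import Data.Fin.Properties using (_≟_)
open import Data.Integer as ℤ using (+_)
import Data.Integer.Properties as ℤ
import Data.Integer.Tactic.RingSolver as ℤSolver
open import Data.List using (length; filter; tabulate)
open import Data.Nat using (ℕ; zero; suc; _+_; _*_; _%_; _≤_; _<_; z≤n; s≤s; s≤s⁻¹; _≡ᵇ_; _<ᵇ_)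
open import Data.Nat.DivMod using (m*n%n≡0; [m+kn]%n≡m%n)
open import Data.Nat.Properties hiding (_≟_)
open import Data.Nat.Tactic.RingSolver using (solve-∀)
open import Data.Product using (∃; ∃₂; _×_; _,_; proj₁; proj₂)
open import Data.Sum using (_⊎_; inj₁; inj₂)
open import Defs hiding (sym)
open import Function using (_∘_; case_of_)
open import Function.Bundles using (Injection)
open import Function.Properties.Inverse using (↔⇒↣)
open import Relation.Binary.PropositionalEquality
open import Relation.Nullary using (yes; no; does)
open import Relation.Nullary.Decidable using (dec-true; dec-false)
open import Algebra.Properties.Semiring.Sum +-*-semiring
  using (sum-syntax; sum-cong-≗; ∑-distrib-+; *-distribˡ-sum; *-distribʳ-sum)

∧≡true⇒ˡ : ∀ {a b} → a ∧ b ≡ true → a ≡ true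
∧≡true⇒ˡ {true} _ = refl

∧≡true⇒ʳ : ∀ {a b} → a ∧ b ≡ true → b ≡ true
∧≡true⇒ʳ {true} b≡true = b≡true

xor≡false⇒≡ : ∀ {a b} → a xor b ≡ false → a ≡ b
xor≡false⇒≡ {true}  {true}  _ = refl
xor≡false⇒≡ {false} {false} _ = refl

xor≡true⇒≡not : ∀ {a b} → a xor b ≡ true → a ≡ not b
xor≡true⇒≡not {true}  {false} _ = refl
xor≡true⇒≡not {false} {true}  _ = refl

-- Counting vertices

indicator : Bool → ℕ
indicator true  = 1
indicator false = 0

count : ∀ {n} → (Fin n → Bool) → ℕ
count {n} p = ∑[ x < n ] indicator (p x)

_∖_ : ∀ {n} → (Fin n → Bool) → Fin n → Fin n → Bool
(p ∖ x) w = p w ∧ not (does (w ≟ x))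

count-cong : ∀ {n} {p q : Fin n → Bool} → (∀ x → p x ≡ q x) → count p ≡ count q
count-cong p≗q = sum-cong-≗ (cong indicator ∘ p≗q)

count-split : ∀ {n} (p q : Fin n → Bool) →
              count p ≡ count (λ x → p x ∧ q x) + count (λ x → p x ∧ not (q x))
count-split p q = trans (sum-cong-≗ split)
  (∑-distrib-+ (λ x → indicator (p x ∧ q x)) (λ x → indicator (p x ∧ not (q x))))
  where
  split : ∀ x → indicator (p x) ≡ indicator (p x ∧ q x) + indicator (p x ∧ not (q x))
  split x with p x | q x
  ... | true  | true  = refl
  ... | true  | false = refl
  ... | false | _     = refl

count-all : ∀ n → count {n} (λ _ → true) ≡ n
count-all zero    = refl
count-all (suc n) = cong suc (count-all n)

count-mono : ∀ {n} {p q : Fin n → Bool} → (∀ x → p x ≡ true → q x ≡ true) → count p ≤ count q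
count-mono {zero}          p⊆q = z≤n
count-mono {suc n} {p} {q} p⊆q with p zero in p₀ | q zero in q₀
... | true  | true  = s≤s (count-mono (p⊆q ∘ suc))
... | true  | false with () ← trans (sym (p⊆q zero p₀)) q₀
... | false | true  = m≤n⇒m≤1+n (count-mono (p⊆q ∘ suc))
... | false | false = count-mono (p⊆q ∘ suc)

count-none : ∀ {n} {p : Fin n → Bool} → (∀ x → p x ≡ false) → count p ≡ 0
count-none {zero}          _    = refl
count-none {suc n} {p} none rewrite none zero = count-none (none ∘ suc)

count-pos : ∀ {n} {p : Fin n → Bool} x → p x ≡ true → 0 < count p
count-pos {p = p} zero px rewrite px = s≤s z≤n
count-pos {p = p} (suc x) px with p zero
... | true  = s≤s z≤n
... | false = count-pos x px

count-witness : ∀ {n} (p : Fin n → Bool) → 0 < count p → ∃ λ x → p x ≡ true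
count-witness {suc n} p 0<c with p zero in p₀
... | true  = zero , p₀
... | false with x , px ← count-witness (p ∘ suc) 0<c = suc x , px

count≡0⇒none : ∀ {n} {p : Fin n → Bool} → count p ≡ 0 → ∀ x → p x ≡ false
count≡0⇒none {p = p} c≡0 x with p x in px
... | false = refl
... | true  = ⊥-elim (<⇒≢ (count-pos x px) (sym c≡0))

search : ∀ {n} (p : Fin n → Bool) → (∃ λ x → p x ≡ true) ⊎ (∀ x → p x ≡ false)
search p with count p in c
... | zero  = inj₂ (count≡0⇒none c)
... | suc _ = inj₁ (count-witness p (subst (0 <_) (sym c) (s≤s z≤n)))

count-∖ : ∀ {n} {p : Fin n → Bool} x → p x ≡ true → count p ≡ suc (count (p ∖ x))
count-∖ {suc n} {p} zero px rewrite px =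
  cong suc (count-cong λ w → sym (∧-identityʳ (p (suc w))))
count-∖ {suc n} {p} (suc x) px with p zero
... | true  = cong suc (count-∖ x px)
... | false = count-∖ x px

∖⇒≢ : ∀ {n} {p : Fin n → Bool} {x y} → (p ∖ x) y ≡ true → y ≢ x
∖⇒≢ {p = p} {x} h refl rewrite dec-true (x ≟ x) refl | ∧-zeroʳ (p x) = case h of λ ()

∖-decompose : ∀ {n} {p : Fin n → Bool} {x} → p x ≡ true → ∀ w → p w ≡ does (w ≟ x) ∨ (p ∖ x) w
∖-decompose {p = p} {x} px w with w ≟ x
... | yes refl = px
... | no _     = sym (∧-identityʳ (p w))

count-full : ∀ {n} {p q : Fin n → Bool} → (∀ x → p x ≡ true → q x ≡ true) → count q ≤ count p →
             ∀ x → q x ≡ true → p x ≡ true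
count-full {p = p} {q} p⊆q q≤p x qx with p x in px
... | true  = refl
... | false = ⊥-elim (<⇒≱ (≤-<-trans (count-mono p⊆q∖x) (≤-reflexive (sym (count-∖ x qx)))) q≤p)
  where
  p⊆q∖x : ∀ w → p w ≡ true → (q ∖ x) w ≡ true
  p⊆q∖x w pw with w ≟ x
  ... | yes refl = ⊥-elim (case trans (sym px) pw of λ ())
  ... | no _ rewrite p⊆q w pw = refl

count≡1 : ∀ {n} {p : Fin n → Bool} {x} → count p ≡ 1 → p x ≡ true → ∀ w → p w ≡ does (w ≟ x)
count≡1 {p = p} {x} c≡1 px w = begin
  p w                       ≡⟨ ∖-decompose px w ⟩
  does (w ≟ x) ∨ (p ∖ x) w  ≡⟨ cong (does (w ≟ x) ∨_) (count≡0⇒none c∖≡0 w) ⟩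
  does (w ≟ x) ∨ false      ≡⟨ ∨-identityʳ _ ⟩
  does (w ≟ x)              ∎
  where
  open ≡-Reasoning
  c∖≡0 : count (p ∖ x) ≡ 0
  c∖≡0 = suc-injective (trans (sym (count-∖ x px)) c≡1)

count≡2 : ∀ {n} {p : Fin n → Bool} {x} → count p ≡ 2 → p x ≡ true →
          ∃ λ y → y ≢ x × ∀ w → p w ≡ does (w ≟ x) ∨ does (w ≟ y)
count≡2 {p = p} {x} c≡2 px = pair (count-witness (p ∖ x) (subst (0 <_) (sym c∖≡1) (s≤s z≤n)))
  where
  c∖≡1 : count (p ∖ x) ≡ 1
  c∖≡1 = suc-injective (trans (sym (count-∖ x px)) c≡2)
  pair : (∃ λ y → (p ∖ x) y ≡ true) → ∃ λ y → y ≢ x × ∀ w → p w ≡ does (w ≟ x) ∨ does (w ≟ y)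
  pair (y , p∖x[y]) =
    y , ∖⇒≢ {p = p} p∖x[y] , λ w → trans (∖-decompose px w) (cong (does (w ≟ x) ∨_) (count≡1 c∖≡1 p∖x[y] w))

∑-indicator : ∀ {n} (P : Fin n → Bool) k → ∑[ x < n ] (indicator (P x) * k) ≡ count P * k
∑-indicator P k = sym (*-distribʳ-sum k (indicator ∘ P))

Even : ℕ → Set
Even m = ∃ λ k → m ≡ 2 * k

∑∑-symmetric-even : ∀ {n} (f : Fin n → Fin n → ℕ) → (∀ x y → f x y ≡ f y x) → (∀ x → f x x ≡ 0) →
                    Even (∑[ x < n ] ∑[ y < n ] f x y)
∑∑-symmetric-even {zero}  f f-sym f-diag = 0 , refl
∑∑-symmetric-even {suc n} f f-sym f-diag
  with k , rest≡2k ← ∑∑-symmetric-even (λ x y → f (suc x) (suc y)) (λ x y → f-sym (suc x) (suc y)) (f-diag ∘ suc) =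
  row + k , (begin
    f zero zero + row + ∑[ x < n ] (f (suc x) zero + ∑[ y < n ] f (suc x) (suc y))
      ≡⟨ cong₂ _+_ (cong (_+ row) (f-diag zero)) (∑-distrib-+ (λ x → f (suc x) zero) _) ⟩
    row + (∑[ x < n ] f (suc x) zero + ∑[ x < n ] ∑[ y < n ] f (suc x) (suc y))
      ≡⟨ cong₂ (λ r s → row + (r + s)) (sum-cong-≗ (λ x → f-sym (suc x) zero)) rest≡2k ⟩
    row + (row + 2 * k)
      ≡⟨ double row k ⟩
    2 * (row + k) ∎)
  where
  open ≡-Reasoning
  row : ℕ
  row = ∑[ y < n ] f zero (suc y)
  double : ∀ r k → r + (r + 2 * k) ≡ 2 * (r + k)
  double = solve-∀

-- Degrees within a vertex set

module _ {n} (G : Graph n) where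

  degIn : (Fin n → Bool) → Fin n → ℕ
  degIn P u = count (λ w → adj G u w ∧ P w)

  private
    neighbours⊆others : ∀ P u w → (adj G u w ∧ P w) ≡ true → (P ∖ u) w ≡ true
    neighbours⊆others P u w h with w ≟ u
    ... | yes refl = case trans (sym (irref G u)) (∧≡true⇒ˡ h) of λ ()
    ... | no _ rewrite ∧≡true⇒ʳ {adj G u w} h = refl

  degIn-< : ∀ {P u} → P u ≡ true → degIn P u < count P
  degIn-< {P} {u} Pu = ≤-<-trans (count-mono (neighbours⊆others P u)) (≤-reflexive (sym (count-∖ u Pu)))

  degIn-full : ∀ {P u} → P u ≡ true → suc (degIn P u) ≡ count P →
               ∀ {w} → P w ≡ true → w ≢ u → adj G u w ≡ true
  degIn-full {P} {u} Pu full {w} Pw w≢u = ∧≡true⇒ˡ (count-full (neighbours⊆others P u) others≤deg w others[w])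
    where
    others≤deg : count (P ∖ u) ≤ degIn P u
    others≤deg = ≤-reflexive (suc-injective (trans (sym (count-∖ u Pu)) (sym full)))
    others[w] : (P ∖ u) w ≡ true
    others[w] rewrite Pw | dec-false (w ≟ u) w≢u = refl

  crossing-edge : ∀ (P : Fin n → Bool) {u w} → Reach G u w → P u ≡ true → P w ≡ false →
                 ∃₂ λ x y → P x ≡ true × P y ≡ false × adj G x y ≡ true
  crossing-edge P here Pu Pw = case trans (sym Pu) Pw of λ ()
  crossing-edge P (step {v = v} uv v⇝w) Pu Pw with P v in Pv
  ... | true  = crossing-edge P v⇝w Pv Pw
  ... | false = _ , _ , Pu , Pv , uv

  first-step : ∀ {u w} → Reach G u w → u ≢ w → ∃ λ v → adj G u v ≡ true
  first-step here      u≢u = ⊥-elim (u≢u refl)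
  first-step (step uv _) _ = _ , uv

  degIn-sum-even : (P : Fin n → Bool) → Even (∑[ x < n ] (indicator (P x) * degIn P x))
  degIn-sum-even P = subst Even (sum-cong-≗ row-sum) (∑∑-symmetric-even f f-sym f-diag)
    where
    f : Fin n → Fin n → ℕ
    f x w = indicator (P x) * indicator (adj G x w ∧ P w)
    row-sum : ∀ x → ∑[ w < n ] f x w ≡ indicator (P x) * degIn P x
    row-sum x = sym (*-distribˡ-sum (indicator (P x)) (λ w → indicator (adj G x w ∧ P w)))
    f-sym : ∀ x w → f x w ≡ f w x
    f-sym x w rewrite Graph.sym G x w with adj G w x
    ... | true  = *-comm (indicator (P x)) (indicator (P w))
    ... | false = trans (*-zeroʳ (indicator (P x))) (sym (*-zeroʳ (indicator (P w))))
    f-diag : ∀ x → f x x ≡ 0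
    f-diag x rewrite irref G x = *-zeroʳ (indicator (P x))

-- Hub graphs

toℕ-≡ᵇ : ∀ {n} (u w : Fin n) → (toℕ u ≡ᵇ toℕ w) ≡ does (u ≟ w)
toℕ-≡ᵇ zero    zero    = refl
toℕ-≡ᵇ zero    (suc w) = refl
toℕ-≡ᵇ (suc u) zero    = refl
toℕ-≡ᵇ (suc u) (suc w) = toℕ-≡ᵇ u w

toℕ-<ᵇ2 : ∀ {n} (u : Fin (suc (suc n))) → (toℕ u <ᵇ 2) ≡ does (u ≟ zero) ∨ does (u ≟ suc zero)
toℕ-<ᵇ2 zero          = refl
toℕ-<ᵇ2 (suc zero)    = refl
toℕ-<ᵇ2 (suc (suc u)) = refl

module _ {n} (π : Permutation′ n) where
  ≟-permute : ∀ u w → does (π ⟨$⟩ʳ u ≟ π ⟨$⟩ʳ w) ≡ does (u ≟ w)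
  ≟-permute u w with u ≟ w | π ⟨$⟩ʳ u ≟ π ⟨$⟩ʳ w
  ... | yes _    | yes _   = refl
  ... | no _     | no _    = refl
  ... | yes refl | no πu≢πu = ⊥-elim (πu≢πu refl)
  ... | no u≢w   | yes πu≡πw = ⊥-elim (u≢w (Injection.injective (↔⇒↣ π) πu≡πw))

transpose-source : ∀ {n} (i j : Fin n) → transpose i j ⟨$⟩ʳ i ≡ j
transpose-source i j rewrite dec-true (i ≟ i) refl = refl

transpose-fixed : ∀ {n} (i j k : Fin n) → k ≢ i → k ≢ j → transpose i j ⟨$⟩ʳ k ≡ k
transpose-fixed i j k k≢i k≢j rewrite dec-false (k ≟ i) k≢i | dec-false (k ≟ j) k≢j = refl

-- Kₙ, K₁,ₙ₋₁ and P₂ ∨ Iₙ₋₂ are the graphs whose hubs H (all vertices, one vertex,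
-- two vertices) are adjacent to every other vertex while no two non-hubs are adjacent.
HubAdjacency : ∀ {n} → Graph n → (Fin n → Bool) → Set
HubAdjacency {n} G H = ∀ u w → adj G u w ≡ not (does (u ≟ w)) ∧ (H u ∨ H w)

single-hub-xor : ∀ {n} (u w c : Fin n) →
                not (does (u ≟ w)) ∧ (does (u ≟ c) ∨ does (w ≟ c)) ≡ does (u ≟ c) xor does (w ≟ c)
single-hub-xor u w c with u ≟ c | w ≟ c
... | yes refl | yes refl rewrite dec-true (u ≟ u) refl = refl
... | yes refl | no w≢u   rewrite dec-false (u ≟ w) (w≢u ∘ sym) = refl
... | no u≢c   | yes refl rewrite dec-false (u ≟ w) u≢c = refl
... | no _     | no _     = ∧-zeroʳ _

hubAdjacency-cong : ∀ {n} {G : Graph n} {H H' : Fin n → Bool} → (∀ u → H u ≡ H' u) →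
                    HubAdjacency G H → HubAdjacency G H'
hubAdjacency-cong H≗H' hub u w =
  trans (hub u w) (cong₂ (λ s t → not (does (u ≟ w)) ∧ (s ∨ t)) (H≗H' u) (H≗H' w))

complete-iso : ∀ {n} (G : Graph n) → (∀ u w → adj G u w ≡ not (does (u ≟ w))) → IsoTo G completeAdj
complete-iso G complete = id , λ u w → trans (complete u w) (cong not (sym (toℕ-≡ᵇ u w)))

star-iso : ∀ {n} (G : Graph n) c → HubAdjacency G (λ u → does (u ≟ c)) → IsoTo G starAdj
star-iso {suc _} G c hub = π , λ u w → begin
    adj G u w                                           ≡⟨ hub u w ⟩
    not (does (u ≟ w)) ∧ (does (u ≟ c) ∨ does (w ≟ c))  ≡⟨ single-hub-xor u w c ⟩
    does (u ≟ c) xor does (w ≟ c)                       ≡⟨ cong₂ _xor_ (centre u) (centre w) ⟩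
    starAdj (π ⟨$⟩ʳ u) (π ⟨$⟩ʳ w)                        ∎
  where
  open ≡-Reasoning
  π : Permutation′ _
  π = transpose c zero
  centre : ∀ u → does (u ≟ c) ≡ (toℕ (π ⟨$⟩ʳ u) ≡ᵇ 0)
  centre u = begin
    does (u ≟ c)                  ≡⟨ ≟-permute π u c ⟨
    does (π ⟨$⟩ʳ u ≟ π ⟨$⟩ʳ c)    ≡⟨ cong (λ v → does (π ⟨$⟩ʳ u ≟ v)) (transpose-source c zero) ⟩
    does (π ⟨$⟩ʳ u ≟ zero)        ≡⟨ toℕ-≡ᵇ (π ⟨$⟩ʳ u) zero ⟨
    (toℕ (π ⟨$⟩ʳ u) ≡ᵇ 0)         ∎

p2Join-iso : ∀ {n} (G : Graph n) {y f} → y ≢ f →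
             HubAdjacency G (λ u → does (u ≟ y) ∨ does (u ≟ f)) → IsoTo G p2JoinIAdj
p2Join-iso {suc zero}    G {zero} {zero} y≢f hub = ⊥-elim (y≢f refl)
p2Join-iso {suc (suc _)} G {y}    {f}    y≢f hub = π , λ u w → begin
    adj G u w
      ≡⟨ hub u w ⟩
    not (does (u ≟ w)) ∧ ((does (u ≟ y) ∨ does (u ≟ f)) ∨ (does (w ≟ y) ∨ does (w ≟ f)))
      ≡⟨ cong₂ (λ e h → not e ∧ h) (trans (toℕ-≡ᵇ (π ⟨$⟩ʳ u) (π ⟨$⟩ʳ w)) (≟-permute π u w))
               (cong₂ _∨_ (hubs u) (hubs w)) ⟨
    p2JoinIAdj (π ⟨$⟩ʳ u) (π ⟨$⟩ʳ w)
      ∎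
  where
  open ≡-Reasoning
  ρ σ π : Permutation′ _
  ρ = transpose y zero
  σ = transpose (ρ ⟨$⟩ʳ f) (suc zero)
  π = ρ ∘ₚ σ
  ρf≢0 : ρ ⟨$⟩ʳ f ≢ zero
  ρf≢0 ρf≡0 = y≢f (Injection.injective (↔⇒↣ ρ) (trans (transpose-source y zero) (sym ρf≡0)))
  πy≡0 : π ⟨$⟩ʳ y ≡ zero
  πy≡0 = trans (cong (σ ⟨$⟩ʳ_) (transpose-source y zero)) (transpose-fixed _ _ zero (ρf≢0 ∘ sym) λ ())
  πf≡1 : π ⟨$⟩ʳ f ≡ suc zero
  πf≡1 = transpose-source (ρ ⟨$⟩ʳ f) (suc zero)
  image : ∀ u x {i} → π ⟨$⟩ʳ x ≡ i → does (π ⟨$⟩ʳ u ≟ i) ≡ does (u ≟ x)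
  image u x refl = ≟-permute π u x
  hubs : ∀ u → (toℕ (π ⟨$⟩ʳ u) <ᵇ 2) ≡ does (u ≟ y) ∨ does (u ≟ f)
  hubs u = trans (toℕ-<ᵇ2 (π ⟨$⟩ʳ u)) (cong₂ _∨_ (image u y πy≡0) (image u f πf≡1))

Classified : ∀ {n} → Graph n → Set
Classified {n} G = (n % 2 ≡ 0 → IsoTo G starAdj ⊎ IsoTo G completeAdj) ×
                   (n % 2 ≡ 1 → IsoTo G p2JoinIAdj ⊎ IsoTo G completeAdj)

module _ {n} (G : Graph n) where

  complete⇒classified : IsoTo G completeAdj → Classified G
  complete⇒classified iso = (λ _ → inj₂ iso) , (λ _ → inj₂ iso)

  private
    double : ∀ m → m + m ≡ m * 2
    double = solve-∀

  star⇒classified : ∀ m → n ≡ m + m → IsoTo G starAdj → Classified G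
  star⇒classified m n≡2m iso = (λ _ → inj₁ iso) , λ odd → case trans (sym even) odd of λ ()
    where
    even : n % 2 ≡ 0
    even = trans (cong (_% 2) (trans n≡2m (double m))) (m*n%n≡0 m 2)

  p2Join⇒classified : ∀ m → n ≡ suc m + m → IsoTo G p2JoinIAdj → Classified G
  p2Join⇒classified m n≡2m+1 iso = (λ even → case trans (sym odd) even of λ ()) , (λ _ → inj₁ iso)
    where
    odd : n % 2 ≡ 1
    odd = trans (cong (_% 2) (trans n≡2m+1 (cong suc (double m)))) ([m+kn]%n≡m%n 1 m 2)

-- Parity signed graphs

countV≡count : ∀ {n} (p : Fin n → Bool) → countV p ≡ count p
countV≡count {n} p = tabulated (λ x → x)
  where
  tabulated : ∀ {m} (f : Fin m → Fin n) →
              length (filter (λ v → p v ≟ᴮ true) (tabulate f)) ≡ count (p ∘ f)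
  tabulated {zero}  f = refl
  tabulated {suc m} f with p (f zero)
  ... | true  = cong suc (tabulated (f ∘ suc))
  ... | false = tabulated (f ∘ suc)

edgeWeight : Bool → ℕ
edgeWeight true  = 2
edgeWeight false = 0

edgeWeight-injective : ∀ {a b} → edgeWeight a ≡ edgeWeight b → a ≡ b
edgeWeight-injective {true}  {true}  _ = refl
edgeWeight-injective {false} {false} _ = refl

edgeWeight-gap : ∀ {a b} → 2 + edgeWeight a ≡ edgeWeight b → a ≡ false × b ≡ true
edgeWeight-gap {false} {true} _ = refl , refl

Equitable : ∀ {n} → (Fin n → Bool) → Set
Equitable part = count part ≤ suc (count (not ∘ part)) × count (not ∘ part) ≤ suc (count part)

equitable-swap : ∀ {n} {part : Fin n → Bool} → Equitable part → Equitable (not ∘ part)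
equitable-swap {part = part} (V₁≤ , V₂≤) =
  subst (count (not ∘ part) ≤_) (cong suc (sym notnot)) V₂≤ ,
  subst (_≤ suc (count (not ∘ part))) (sym notnot) V₁≤
  where
  notnot : count (not ∘ not ∘ part) ≡ count part
  notnot = count-cong (not-involutive ∘ part)

sides-nonempty : ∀ {n} {part : Fin n → Bool} → 2 ≤ n → Equitable part →
                 (∃ λ x₁ → part x₁ ≡ true) × (∃ λ x₂ → part x₂ ≡ false)
sides-nonempty {n} {part} 2≤n (V₁≤ , V₂≤)
  with count-witness part (nonempty V₂≤ 2≤a+b)
     | count-witness (not ∘ part) (nonempty V₁≤ (subst (2 ≤_) (+-comm a b) 2≤a+b))
  where
  a b : ℕ
  a = count part
  b = count (not ∘ part)
  2≤a+b : 2 ≤ a + b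
  2≤a+b = subst (2 ≤_) (trans (sym (count-all n)) (count-split (λ _ → true) part)) 2≤n
  nonempty : ∀ {c d} → d ≤ suc c → 2 ≤ c + d → 0 < c
  nonempty {zero}  d≤1 2≤d = ⊥-elim (<⇒≱ 2≤d d≤1)
  nonempty {suc c} _   _   = s≤s z≤n
... | x₁ , x₁∈V₁ | x₂ , x₂∈V₂ = (x₁ , x₁∈V₁) , (x₂ , not-injective x₂∈V₂)

-- d⁻ and d⁺ of a parity signed graph, expressed through the partition alone (justified by isNeg-crossing).
module _ {n} (G : Graph n) (part : Fin n → Bool) where

  d⁻ d⁺ : Fin n → ℕ
  d⁻ u = degIn G (λ w → part u xor part w) u
  d⁺ u = degIn G (λ w → not (part u xor part w)) u

  Δ : Fin n → ℤ.ℤ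
  Δ u = + d⁻ u ℤ.- + d⁺ u

  Balanced : Set
  Balanced = ∀ u v → part u ≡ true → part v ≡ false → Δ u ℤ.+ Δ v ≡ + edgeWeight (adj G u v)

  Homogeneous : Set
  Homogeneous = ∀ u → part u ≡ true →
                (∀ v → part v ≡ false → adj G u v ≡ true) ⊎
                (∀ v → part v ≡ false → adj G u v ≡ false)

module _ {n} {G : Graph n} {σ : Fin n → Fin n → Sign} {part : Fin n → Bool}
         (parity : IsParityPartition G σ part) where

  isNeg-crossing : ∀ {u w} → adj G u w ≡ true → isNeg (σ u w) ≡ part u xor part w
  isNeg-crossing {u} {w} uw with σ u w | proj₂ parity u w uw
  ... | pos | _ , same rewrite same refl = sym (xor-same (part w))
  ... | neg | opposite , _ with part u | part w
  ...   | true  | false = refl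
  ...   | false | true  = refl
  ...   | true  | true  = case opposite refl of λ ()
  ...   | false | false = case opposite refl of λ ()

  degNeg≡d⁻ : ∀ u → degNeg G σ u ≡ d⁻ G part u
  degNeg≡d⁻ u = trans (countV≡count (λ w → adj G u w ∧ isNeg (σ u w))) (count-cong pointwise)
    where
    pointwise : ∀ w → (adj G u w ∧ isNeg (σ u w)) ≡ (adj G u w ∧ (part u xor part w))
    pointwise w with adj G u w in uw
    ... | true  = isNeg-crossing uw
    ... | false = refl

  degPos≡d⁺ : ∀ u → degPos G σ u ≡ d⁺ G part u
  degPos≡d⁺ u = trans (countV≡count (λ w → adj G u w ∧ isPos (σ u w))) (count-cong pointwise)
    where
    pointwise : ∀ w → (adj G u w ∧ isPos (σ u w)) ≡ (adj G u w ∧ not (part u xor part w))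
    pointwise w with adj G u w in uw
    ... | true  = cong not (isNeg-crossing uw)
    ... | false = refl

  degΔ≡Δ : ∀ x → degΔ G σ x ≡ Δ G part x
  degΔ≡Δ x = cong₂ (λ a b → + a ℤ.- + b) (degNeg≡d⁻ x) (degPos≡d⁺ x)

  degreeBalanced⇒balanced : DegreeBalanced G σ part → Balanced G part
  degreeBalanced⇒balanced degBal u v u∈V₁ v∈V₂ with adj G u v | degBal u v u∈V₁ v∈V₂
  ... | true  | onEdge , _  = trans (sym (cong₂ ℤ._+_ (degΔ≡Δ u) (degΔ≡Δ v))) (onEdge refl)
  ... | false | _ , offEdge = trans (sym (cong₂ ℤ._+_ (degΔ≡Δ u) (degΔ≡Δ v))) (offEdge refl)

  parity⇒equitable : Equitable part
  parity⇒equitable =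
    subst₂ (λ a b → a ≤ suc b) (countV≡count part) (countV≡count (not ∘ part)) (proj₁ (proj₁ parity)) ,
    subst₂ (λ a b → a ≤ suc b) (countV≡count (not ∘ part)) (countV≡count part) (proj₂ (proj₁ parity))

module _ {n} {G : Graph n} {part : Fin n → Bool} where

  private
    not-xor-not : ∀ a b → (not a xor not b) ≡ (a xor b)
    not-xor-not true  b = refl
    not-xor-not false b = not-involutive b

    Δ-swap : ∀ u → Δ G (not ∘ part) u ≡ Δ G part u
    Δ-swap u = cong₂ (λ a b → + a ℤ.- + b)
      (count-cong λ w → cong (adj G u w ∧_) (not-xor-not (part u) (part w)))
      (count-cong λ w → cong (λ b → adj G u w ∧ not b) (not-xor-not (part u) (part w)))

  balanced-swap : Balanced G part → Balanced G (not ∘ part)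
  balanced-swap balanced u v u∈V₂ v∈V₁ = begin
    Δ G (not ∘ part) u ℤ.+ Δ G (not ∘ part) v  ≡⟨ cong₂ ℤ._+_ (Δ-swap u) (Δ-swap v) ⟩
    Δ G part u ℤ.+ Δ G part v                  ≡⟨ ℤ.+-comm (Δ G part u) (Δ G part v) ⟩
    Δ G part v ℤ.+ Δ G part u                  ≡⟨ balanced v u (not-injective v∈V₁) (not-injective u∈V₂) ⟩
    + edgeWeight (adj G v u)                   ≡⟨ cong (+_ ∘ edgeWeight) (Graph.sym G v u) ⟩
    + edgeWeight (adj G u v)                   ∎
    where open ≡-Reasoning

-- Degree balance

differences-sum : ∀ a b c d k → (+ a ℤ.- + b) ℤ.+ (+ c ℤ.- + d) ≡ + k → a + c ≡ b + d + k
differences-sum a b c d k sum≡k = ℤ.+-injective (begin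
  + (a + c)                                               ≡⟨ ℤ.pos-+ a c ⟩
  + a ℤ.+ + c                                             ≡⟨ regroup (+ a) (+ b) (+ c) (+ d) ⟩
  ((+ a ℤ.- + b) ℤ.+ (+ c ℤ.- + d)) ℤ.+ (+ b ℤ.+ + d)     ≡⟨ cong₂ ℤ._+_ sum≡k (sym (ℤ.pos-+ b d)) ⟩
  + k ℤ.+ + (b + d)                                       ≡⟨ sym (ℤ.pos-+ k (b + d)) ⟩
  + (k + (b + d))                                         ≡⟨ cong +_ (+-comm k (b + d)) ⟩
  + (b + d + k)                                           ∎)
  where
  open ≡-Reasoning
  regroup : ∀ a b c d → a ℤ.+ c ≡ ((a ℤ.- b) ℤ.+ (c ℤ.- d)) ℤ.+ (b ℤ.+ d)
  regroup = ℤSolver.solve-∀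

module _ {n} {G : Graph n} {part : Fin n → Bool} (balanced : Balanced G part) where

  balanced-ℕ : ∀ {u v} → part u ≡ true → part v ≡ false →
               d⁻ G part u + d⁻ G part v ≡ d⁺ G part u + d⁺ G part v + edgeWeight (adj G u v)
  balanced-ℕ {u} {v} u∈V₁ v∈V₂ =
    differences-sum (d⁻ G part u) (d⁺ G part u) (d⁻ G part v) (d⁺ G part v) _ (balanced u v u∈V₁ v∈V₂)

  -- Both sides are Δu + Δv + Δu' + Δv', grouped along the two diagonals of u v u' v'.
  quadrilateral : ∀ {u u' v v'} → part u ≡ true → part u' ≡ true → part v ≡ false → part v' ≡ false →
                  edgeWeight (adj G u v) + edgeWeight (adj G u' v') ≡ edgeWeight (adj G u v') + edgeWeight (adj G u' v)
  quadrilateral {u} {u'} {v} {v'} u∈V₁ u'∈V₁ v∈V₂ v'∈V₂ = ℤ.+-injective (begin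
    + (edgeWeight (adj G u v) + edgeWeight (adj G u' v'))
      ≡⟨ ℤ.pos-+ (edgeWeight (adj G u v)) (edgeWeight (adj G u' v')) ⟩
    + edgeWeight (adj G u v) ℤ.+ + edgeWeight (adj G u' v')
      ≡⟨ cong₂ ℤ._+_ (balanced u v u∈V₁ v∈V₂) (balanced u' v' u'∈V₁ v'∈V₂) ⟨
    (Δ G part u ℤ.+ Δ G part v) ℤ.+ (Δ G part u' ℤ.+ Δ G part v')
      ≡⟨ exchange (Δ G part u) (Δ G part v) (Δ G part u') (Δ G part v') ⟩
    (Δ G part u ℤ.+ Δ G part v') ℤ.+ (Δ G part u' ℤ.+ Δ G part v)
      ≡⟨ cong₂ ℤ._+_ (balanced u v' u∈V₁ v'∈V₂) (balanced u' v u'∈V₁ v∈V₂) ⟩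
    + edgeWeight (adj G u v') ℤ.+ + edgeWeight (adj G u' v)
      ≡⟨ ℤ.pos-+ (edgeWeight (adj G u v')) (edgeWeight (adj G u' v)) ⟨
    + (edgeWeight (adj G u v') + edgeWeight (adj G u' v))
      ∎)
    where
    open ≡-Reasoning
    exchange : ∀ a b c d → (a ℤ.+ b) ℤ.+ (c ℤ.+ d) ≡ (a ℤ.+ d) ℤ.+ (c ℤ.+ b)
    exchange = ℤSolver.solve-∀

  row-transfer : ∀ {u u' v v'} → part u ≡ true → part u' ≡ true → part v ≡ false → part v' ≡ false →
                 adj G u' v ≡ adj G u' v' → adj G u v ≡ adj G u v'
  row-transfer {u} {u'} {v} {v'} u∈V₁ u'∈V₁ v∈V₂ v'∈V₂ u'v≡u'v' = edgeWeight-injective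
    (+-cancelʳ-≡ (edgeWeight (adj G u' v)) _ _
      (subst (λ b → edgeWeight (adj G u v) + edgeWeight b ≡ edgeWeight (adj G u v') + edgeWeight (adj G u' v))
             (sym u'v≡u'v') (quadrilateral u∈V₁ u'∈V₁ v∈V₂ v'∈V₂)))

  mixed⇒swap-homogeneous : ∀ {u v v'} → part u ≡ true → part v ≡ false → part v' ≡ false →
                           adj G u v ≡ false → adj G u v' ≡ true → Homogeneous G (not ∘ part)
  mixed⇒swap-homogeneous {u} {v} {v'} u∈V₁ v∈V₂ v'∈V₂ uv uv' w w∈V₂ with adj G u w in uw
  ... | true  = inj₁ λ x x∈V₁ → trans (Graph.sym G w x) (proj₂ (edgeWeight-gap
        (subst₂ (λ a b → edgeWeight a + edgeWeight (adj G x v) ≡ edgeWeight b + edgeWeight (adj G x w)) uw uv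
                (quadrilateral u∈V₁ (not-injective x∈V₁) (not-injective w∈V₂) v∈V₂))))
  ... | false = inj₂ λ x x∈V₁ → trans (Graph.sym G w x) (proj₁ (edgeWeight-gap
        (subst₂ (λ a b → edgeWeight a + edgeWeight (adj G x w) ≡ edgeWeight b + edgeWeight (adj G x v')) uv' uw
                (quadrilateral u∈V₁ (not-injective x∈V₁) v'∈V₂ (not-injective w∈V₂)))))

  -- Only the row of x₁ matters: if it is constant on V₂, row-transfer makes every row
  -- of V₁ constant; otherwise x₁ itself is mixed.
  dichotomy : ∀ {x₁ x₂} → part x₁ ≡ true → part x₂ ≡ false → Homogeneous G part ⊎ Homogeneous G (not ∘ part)
  dichotomy {x₁} {x₂} x₁∈V₁ x₂∈V₂ with search (λ v → not (part v) ∧ (adj G x₁ v xor adj G x₁ x₂))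
  ... | inj₂ rowConstant = inj₁ homogeneous
    where
    row : ∀ {v} → part v ≡ false → adj G x₁ v ≡ adj G x₁ x₂
    row {v} v∈V₂ =
      xor≡false⇒≡ (subst (λ b → not b ∧ (adj G x₁ v xor adj G x₁ x₂) ≡ false) v∈V₂ (rowConstant v))
    homogeneous : Homogeneous G part
    homogeneous u u∈V₁ with adj G u x₂ in ux₂
    ... | true  = inj₁ λ v v∈V₂ → trans (row-transfer u∈V₁ x₁∈V₁ v∈V₂ x₂∈V₂ (row v∈V₂)) ux₂
    ... | false = inj₂ λ v v∈V₂ → trans (row-transfer u∈V₁ x₁∈V₁ v∈V₂ x₂∈V₂ (row v∈V₂)) ux₂
  ... | inj₁ (v , rowChanges) =
    inj₂ (mixed (not-injective (∧≡true⇒ˡ rowChanges)) (xor≡true⇒≡not (∧≡true⇒ʳ {not (part v)} rowChanges)))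
    where
    mixed : part v ≡ false → adj G x₁ v ≡ not (adj G x₁ x₂) → Homogeneous G (not ∘ part)
    mixed v∈V₂ x₁v with adj G x₁ x₂ in x₁x₂
    ... | true  = mixed⇒swap-homogeneous x₁∈V₁ v∈V₂ x₂∈V₂ x₁v x₁x₂
    ... | false = mixed⇒swap-homogeneous x₁∈V₁ x₂∈V₂ v∈V₂ x₁x₂ x₁v

-- The homogeneous case

tight : ∀ {a b x y} → x < a → y < b → a + b ≡ x + y + 2 → suc x ≡ a × suc y ≡ b
tight {a} {b} {x} {y} x<a y<b a+b≡ = ≤-antisym x<a a≤1+x , ≤-antisym y<b b≤1+y
  where
  a+b≡' : a + b ≡ suc x + suc y
  a+b≡' = trans a+b≡ (shift x y)
    where
    shift : ∀ x y → x + y + 2 ≡ suc x + suc y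
    shift = solve-∀
  a≤1+x : a ≤ suc x
  a≤1+x = +-cancelʳ-≤ b a (suc x) (≤-trans (≤-reflexive a+b≡') (+-monoʳ-≤ (suc x) y<b))
  b≤1+y : b ≤ suc y
  b≤1+y = +-cancelˡ-≤ a b (suc y) (≤-trans (≤-reflexive a+b≡') (+-monoˡ-≤ (suc y) x<a))

degree-sums-not-both-even : ∀ β p' q {k₁ k₂} → q + p' ≡ suc β →
                            2 * k₁ ≡ suc p' * β + q * 1 → 2 * k₂ ≡ suc β * p' → ⊥
degree-sums-not-both-even β p' q {k₁} {k₂} q+p'≡1+β e₁ e₂ = even≢odd (k₁ + k₂) (β * p' + β) (begin
  2 * (k₁ + k₂)                     ≡⟨ *-distribˡ-+ 2 k₁ k₂ ⟩
  2 * k₁ + 2 * k₂                   ≡⟨ cong₂ _+_ e₁ e₂ ⟩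
  suc p' * β + q * 1 + suc β * p'   ≡⟨ regroup β p' q ⟩
  2 * (β * p') + β + (q + p')       ≡⟨ cong (λ t → 2 * (β * p') + β + t) q+p'≡1+β ⟩
  2 * (β * p') + β + suc β          ≡⟨ close β p' ⟩
  suc (2 * (β * p' + β))            ∎)
  where
  open ≡-Reasoning
  regroup : ∀ β p' q → suc p' * β + q * 1 + suc β * p' ≡ 2 * (β * p') + β + (q + p')
  regroup = solve-∀
  close : ∀ β p' → 2 * (β * p') + β + suc β ≡ suc (2 * (β * p' + β))
  close = solve-∀

module HomogeneousCase {n} {G : Graph n} {part : Fin n → Bool}
  (connected : Connected G) (equitable : Equitable part) (balanced : Balanced G part)
  (homogeneous : Homogeneous G part) {x₁ x₂ : Fin n} (x₁∈V₁ : part x₁ ≡ true) (x₂∈V₂ : part x₂ ≡ false)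
  where

  A : Fin n → Fin n → Bool
  A = adj G

  δ⁻ δ⁺ : Fin n → ℕ
  δ⁻ = d⁻ G part
  δ⁺ = d⁺ G part

  -- By homogeneity, adjacency to the fixed x₂ ∈ V₂ decides whether u ∈ V₁ is adjacent
  -- to all of V₂ (a hub, F) or to none of it (Z).
  F Z : Fin n → Bool
  F u = part u ∧ A u x₂
  Z u = part u ∧ not (A u x₂)

  a b p : ℕ
  a = count part
  b = count (not ∘ part)
  p = count F

  n≡a+b : n ≡ a + b
  n≡a+b = trans (sym (count-all n)) (count-split (λ _ → true) part)

  F⇒V₁ : ∀ {u} → F u ≡ true → part u ≡ true
  F⇒V₁ = ∧≡true⇒ˡ

  Z⇒V₁ : ∀ {u} → Z u ≡ true → part u ≡ true
  Z⇒V₁ = ∧≡true⇒ˡ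

  F-complete : ∀ {u v} → F u ≡ true → part v ≡ false → A u v ≡ true
  F-complete {u} u∈F with homogeneous u (F⇒V₁ u∈F)
  ... | inj₁ complete = complete _
  ... | inj₂ anticomplete = case trans (sym (anticomplete x₂ x₂∈V₂)) (∧≡true⇒ʳ {part u} u∈F) of λ ()

  Z-anticomplete : ∀ {u v} → Z u ≡ true → part v ≡ false → A u v ≡ false
  Z-anticomplete {u} u∈Z with homogeneous u (Z⇒V₁ u∈Z)
  ... | inj₂ anticomplete = anticomplete _
  ... | inj₁ complete = case trans (sym (complete x₂ x₂∈V₂)) (not-injective (∧≡true⇒ʳ {part u} u∈Z)) of λ ()

  crossing⇒F : ∀ {u v} → part u ≡ true → part v ≡ false → A u v ≡ true → F u ≡ true
  crossing⇒F {u} {v} u∈V₁ v∈V₂ uv rewrite u∈V₁ with homogeneous u u∈V₁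
  ... | inj₁ complete     = complete x₂ x₂∈V₂
  ... | inj₂ anticomplete = case trans (sym uv) (anticomplete v v∈V₂) of λ ()

  δ⁺-V₁ : ∀ {u} → part u ≡ true → δ⁺ u ≡ degIn G part u
  δ⁺-V₁ {u} u∈V₁ rewrite u∈V₁ = count-cong λ w → cong (A u w ∧_) (not-involutive (part w))

  δ⁺-V₂ : ∀ {v} → part v ≡ false → δ⁺ v ≡ degIn G (not ∘ part) v
  δ⁺-V₂ {v} v∈V₂ rewrite v∈V₂ = refl

  δ⁻-F : ∀ {u} → F u ≡ true → δ⁻ u ≡ b
  δ⁻-F {u} u∈F rewrite F⇒V₁ u∈F = count-cong pointwise
    where
    pointwise : ∀ w → (A u w ∧ not (part w)) ≡ not (part w)
    pointwise w with part w in w∈V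
    ... | true  = ∧-zeroʳ (A u w)
    ... | false rewrite F-complete u∈F w∈V = refl

  δ⁻-Z : ∀ {u} → Z u ≡ true → δ⁻ u ≡ 0
  δ⁻-Z {u} u∈Z rewrite Z⇒V₁ u∈Z = count-none pointwise
    where
    pointwise : ∀ w → (A u w ∧ not (part w)) ≡ false
    pointwise w with part w in w∈V
    ... | true  = ∧-zeroʳ (A u w)
    ... | false rewrite Z-anticomplete u∈Z w∈V = refl

  δ⁻-V₂ : ∀ {v} → part v ≡ false → δ⁻ v ≡ p
  δ⁻-V₂ {v} v∈V₂ rewrite v∈V₂ = count-cong pointwise
    where
    pointwise : ∀ w → (A v w ∧ part w) ≡ F w
    pointwise w with part w in w∈V | homogeneous w
    ... | false | _ = ∧-zeroʳ (A v w)
    ... | true  | hom with hom refl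
    ...   | inj₁ complete     =
      trans (∧-identityʳ _) (trans (Graph.sym G v w) (trans (complete v v∈V₂) (sym (complete x₂ x₂∈V₂))))
    ...   | inj₂ anticomplete =
      trans (∧-identityʳ _) (trans (Graph.sym G v w) (trans (anticomplete v v∈V₂) (sym (anticomplete x₂ x₂∈V₂))))

  δ⁺<a : ∀ {u} → part u ≡ true → δ⁺ u < a
  δ⁺<a u∈V₁ = subst (_< a) (sym (δ⁺-V₁ u∈V₁)) (degIn-< G {part} u∈V₁)

  δ⁺<b : ∀ {v} → part v ≡ false → δ⁺ v < b
  δ⁺<b v∈V₂ = subst (_< b) (sym (δ⁺-V₂ v∈V₂)) (degIn-< G {not ∘ part} (cong not v∈V₂))

  V₁-full : ∀ {u w} → part u ≡ true → suc (δ⁺ u) ≡ a → part w ≡ true → w ≢ u → A u w ≡ true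
  V₁-full u∈V₁ full = degIn-full G {part} u∈V₁ (trans (cong suc (sym (δ⁺-V₁ u∈V₁))) full)

  V₂-full : ∀ {v w} → part v ≡ false → suc (δ⁺ v) ≡ b → part w ≡ false → w ≢ v → A v w ≡ true
  V₂-full v∈V₂ full w∈V₂ =
    degIn-full G {not ∘ part} (cong not v∈V₂) (trans (cong suc (sym (δ⁺-V₂ v∈V₂))) full) (cong not w∈V₂)

  hub-balance : ∀ {y v} → F y ≡ true → part v ≡ false → b + p ≡ δ⁺ y + δ⁺ v + 2
  hub-balance {y} {v} y∈F v∈V₂ = begin
    b + p                               ≡⟨ cong₂ _+_ (δ⁻-F y∈F) (δ⁻-V₂ v∈V₂) ⟨
    δ⁻ y + δ⁻ v                         ≡⟨ balanced-ℕ {G = G} {part} balanced (F⇒V₁ y∈F) v∈V₂ ⟩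
    δ⁺ y + δ⁺ v + edgeWeight (A y v)    ≡⟨ cong (λ e → δ⁺ y + δ⁺ v + edgeWeight e) (F-complete y∈F v∈V₂) ⟩
    δ⁺ y + δ⁺ v + 2                     ∎
    where open ≡-Reasoning

  nonhub-balance : ∀ {z v} → Z z ≡ true → part v ≡ false → p ≡ δ⁺ z + δ⁺ v
  nonhub-balance {z} {v} z∈Z v∈V₂ = begin
    p                                   ≡⟨ cong₂ _+_ (δ⁻-Z z∈Z) (δ⁻-V₂ v∈V₂) ⟨
    δ⁻ z + δ⁻ v                         ≡⟨ balanced-ℕ {G = G} {part} balanced (Z⇒V₁ z∈Z) v∈V₂ ⟩
    δ⁺ z + δ⁺ v + edgeWeight (A z v)    ≡⟨ cong (λ e → δ⁺ z + δ⁺ v + edgeWeight e) (Z-anticomplete z∈Z v∈V₂) ⟩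
    δ⁺ z + δ⁺ v + 0                     ≡⟨ +-identityʳ _ ⟩
    δ⁺ z + δ⁺ v                         ∎
    where open ≡-Reasoning

  all-hubs⇒complete : (∀ u → Z u ≡ false) → ∀ u w → A u w ≡ not (does (u ≟ w))
  all-hubs⇒complete noZ = adjacency
    where
    V₁⊆F : ∀ {x} → part x ≡ true → F x ≡ true
    V₁⊆F {x} x∈V₁ rewrite x∈V₁ = not-injective (subst (λ t → t ∧ not (A x x₂) ≡ false) x∈V₁ (noZ x))
    F≡V₁ : ∀ x → F x ≡ part x
    F≡V₁ x with part x in x∈V
    ... | true  = trans (cong (_∧ A x x₂) (sym x∈V)) (V₁⊆F x∈V)
    ... | false = refl
    p≡a : p ≡ a
    p≡a = count-cong F≡V₁
    balance : ∀ {x v} → part x ≡ true → part v ≡ false → a + b ≡ δ⁺ x + δ⁺ v + 2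
    balance {x} {v} x∈V₁ v∈V₂ =
      trans (+-comm a b) (subst (λ t → b + t ≡ δ⁺ x + δ⁺ v + 2) p≡a (hub-balance (V₁⊆F x∈V₁) v∈V₂))
    V₁-tight : ∀ {x} → part x ≡ true → suc (δ⁺ x) ≡ a
    V₁-tight x∈V₁ = proj₁ (tight (δ⁺<a x∈V₁) (δ⁺<b x₂∈V₂) (balance x∈V₁ x₂∈V₂))
    V₂-tight : ∀ {v} → part v ≡ false → suc (δ⁺ v) ≡ b
    V₂-tight v∈V₂ = proj₂ (tight (δ⁺<a x₁∈V₁) (δ⁺<b v∈V₂) (balance x₁∈V₁ v∈V₂))
    adjacency : ∀ u w → A u w ≡ not (does (u ≟ w))
    adjacency u w with u ≟ w
    ... | yes refl = irref G u
    ... | no u≢w with part u in u∈V | part w in w∈V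
    ...   | true  | true  = V₁-full u∈V (V₁-tight u∈V) w∈V (u≢w ∘ sym)
    ...   | true  | false = F-complete (V₁⊆F u∈V) w∈V
    ...   | false | true  = trans (Graph.sym G u w) (F-complete (V₁⊆F w∈V) u∈V)
    ...   | false | false = V₂-full u∈V (V₂-tight u∈V) w∈V (u≢w ∘ sym)

  F∩Z-disjoint : ∀ {u} → F u ≡ true → Z u ≡ true → ⊥
  F∩Z-disjoint {u} u∈F u∈Z with part u | A u x₂
  ... | true | true  = case u∈Z of λ ()
  ... | true | false = case u∈F of λ ()

  nonhub-cases : ∀ {u} → F u ≡ false → Z u ≡ true ⊎ part u ≡ false
  nonhub-cases {u} u∉F with part u | A u x₂
  ... | true  | false = inj₁ refl
  ... | false | _     = inj₂ refl

  module WithNonhub {z₀} (z₀∈Z : Z z₀ ≡ true) where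

    hub : ∃ λ y₀ → F y₀ ≡ true
    hub with x , y , x∈V₁ , y∈V₂ , xy ← crossing-edge G part (connected z₀ x₂) (Z⇒V₁ z₀∈Z) x₂∈V₂ =
      x , crossing⇒F x∈V₁ y∈V₂ xy

    z₀≢x₂ : z₀ ≢ x₂
    z₀≢x₂ refl = case trans (sym (Z⇒V₁ z₀∈Z)) x₂∈V₂ of λ ()

    neighbour-in-V₁ : ∀ {w} → A z₀ w ≡ true → (A z₀ w ∧ part w) ≡ true
    neighbour-in-V₁ {w} z₀w with part w in w∈V
    ... | true  rewrite z₀w = refl
    ... | false = case trans (sym z₀w) (Z-anticomplete z₀∈Z w∈V) of λ ()

    δ⁺z₀>0 : 0 < δ⁺ z₀
    δ⁺z₀>0 with w , z₀w ← first-step G (connected z₀ x₂) z₀≢x₂ =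
      subst (0 <_) (sym (δ⁺-V₁ (Z⇒V₁ z₀∈Z))) (count-pos w (neighbour-in-V₁ z₀w))

    y₀ : Fin n
    y₀ = proj₁ hub

    y₀∈F : F y₀ ≡ true
    y₀∈F = proj₂ hub

    hub-vs-nonhub : ∀ {y} → F y ≡ true → 2 + δ⁺ y ≡ δ⁺ z₀ + b
    hub-vs-nonhub {y} y∈F = +-cancelʳ-≡ (δ⁺ x₂) (2 + δ⁺ y) (δ⁺ z₀ + b) (begin
      2 + δ⁺ y + δ⁺ x₂     ≡⟨ rearrange (δ⁺ y) (δ⁺ x₂) ⟩
      δ⁺ y + δ⁺ x₂ + 2     ≡⟨ hub-balance y∈F x₂∈V₂ ⟨
      b + p                ≡⟨ cong (λ t → b + t) (nonhub-balance z₀∈Z x₂∈V₂) ⟩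
      b + (δ⁺ z₀ + δ⁺ x₂)  ≡⟨ rearrange′ b (δ⁺ z₀) (δ⁺ x₂) ⟩
      δ⁺ z₀ + b + δ⁺ x₂    ∎)
      where
      open ≡-Reasoning
      rearrange : ∀ d s → 2 + d + s ≡ d + s + 2
      rearrange = solve-∀
      rearrange′ : ∀ b k s → b + (k + s) ≡ k + b + s
      rearrange′ = solve-∀

    module FullHubs (full : ∀ {y} → F y ≡ true → suc (δ⁺ y) ≡ a) where

      hub-adj : ∀ {y w} → F y ≡ true → w ≢ y → A y w ≡ true
      hub-adj {y} {w} y∈F w≢y with part w in w∈V
      ... | true  = V₁-full (F⇒V₁ y∈F) (full y∈F) w∈V w≢y
      ... | false = F-complete y∈F w∈V

      F⊆N₁ : ∀ {z} → Z z ≡ true → ∀ y → F y ≡ true → (A z y ∧ part y) ≡ true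
      F⊆N₁ {z} z∈Z y y∈F = cong₂ _∧_ (trans (Graph.sym G z y) (hub-adj y∈F z≢y)) (F⇒V₁ y∈F)
        where
        z≢y : z ≢ y
        z≢y refl = F∩Z-disjoint y∈F z∈Z

      p≤δ⁺ : ∀ {z} → Z z ≡ true → p ≤ δ⁺ z
      p≤δ⁺ z∈Z = subst (p ≤_) (sym (δ⁺-V₁ (Z⇒V₁ z∈Z))) (count-mono (F⊆N₁ z∈Z))

      V₂-isolated : ∀ {v} → part v ≡ false → δ⁺ v ≡ 0
      V₂-isolated {v} v∈V₂ = n≤0⇒n≡0 (+-cancelˡ-≤ (δ⁺ z₀) (δ⁺ v) 0 (begin
        δ⁺ z₀ + δ⁺ v  ≡⟨ nonhub-balance z₀∈Z v∈V₂ ⟨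
        p             ≤⟨ p≤δ⁺ z₀∈Z ⟩
        δ⁺ z₀         ≡⟨ +-identityʳ (δ⁺ z₀) ⟨
        δ⁺ z₀ + 0     ∎))
        where open ≤-Reasoning

      δ⁺-Z : ∀ {z} → Z z ≡ true → δ⁺ z ≡ p
      δ⁺-Z {z} z∈Z = sym (begin
        p                ≡⟨ nonhub-balance z∈Z x₂∈V₂ ⟩
        δ⁺ z + δ⁺ x₂     ≡⟨ cong (λ t → δ⁺ z + t) (V₂-isolated x₂∈V₂) ⟩
        δ⁺ z + 0         ≡⟨ +-identityʳ (δ⁺ z) ⟩
        δ⁺ z             ∎)
        where open ≡-Reasoning

      N₁⊆F : ∀ {z} → Z z ≡ true → ∀ w → (A z w ∧ part w) ≡ true → F w ≡ true
      N₁⊆F z∈Z = count-full (F⊆N₁ z∈Z) (≤-reflexive (trans (sym (δ⁺-V₁ (Z⇒V₁ z∈Z))) (δ⁺-Z z∈Z)))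

      nonhub-adj : ∀ {u w} → F u ≡ false → F w ≡ false → A u w ≡ false
      nonhub-adj {u} {w} u∉F w∉F with nonhub-cases u∉F | nonhub-cases w∉F
      ... | inj₁ u∈Z | inj₂ w∈V₂ = Z-anticomplete u∈Z w∈V₂
      ... | inj₂ u∈V₂ | inj₁ w∈Z = trans (Graph.sym G u w) (Z-anticomplete w∈Z u∈V₂)
      ... | inj₂ u∈V₂ | inj₂ w∈V₂ = trans (sym (∧-identityʳ (A u w)))
            (subst (λ t → (A u w ∧ not t) ≡ false) w∈V₂ (count≡0⇒none no-V₂-neighbour w))
        where
        no-V₂-neighbour : degIn G (not ∘ part) u ≡ 0
        no-V₂-neighbour = trans (sym (δ⁺-V₂ u∈V₂)) (V₂-isolated u∈V₂)
      ... | inj₁ u∈Z | inj₁ w∈Z with A u w in uw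
      ...   | false = refl
      ...   | true  = ⊥-elim (F∩Z-disjoint (N₁⊆F u∈Z w (cong₂ _∧_ uw (Z⇒V₁ w∈Z))) w∈Z)

      hubAdjacency : HubAdjacency G F
      hubAdjacency u w with u ≟ w
      ... | yes refl = irref G u
      ... | no u≢w with F u in u∈F | F w in w∈F
      ...   | true  | _     = hub-adj u∈F (u≢w ∘ sym)
      ...   | false | true  = trans (Graph.sym G u w) (hub-adj w∈F u≢w)
      ...   | false | false = nonhub-adj u∈F w∈F

      p≡δ⁺z₀ : p ≡ δ⁺ z₀
      p≡δ⁺z₀ = sym (δ⁺-Z z₀∈Z)

    module OneNeighbour (δ⁺z₀≡1 : δ⁺ z₀ ≡ 1) where

      hub-degree : ∀ {y} → F y ≡ true → suc (δ⁺ y) ≡ b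
      hub-degree y∈F = suc-injective (trans (hub-vs-nonhub y∈F) (cong (_+ b) δ⁺z₀≡1))

      star-case : a ≡ b → IsoTo G starAdj
      star-case a≡b = star-iso G y₀ (hubAdjacency-cong {G = G} (count≡1 p≡1 y₀∈F) hubAdjacency)
        where
        open FullHubs (λ y∈F → trans (hub-degree y∈F) (sym a≡b))
        p≡1 : p ≡ 1
        p≡1 = trans p≡δ⁺z₀ δ⁺z₀≡1

      β p' q : ℕ
      β  = δ⁺ y₀
      p' = δ⁺ x₂
      q  = count Z

      b≡1+β : b ≡ suc β
      b≡1+β = sym (hub-degree y₀∈F)

      p≡1+p' : p ≡ suc p'
      p≡1+p' = trans (nonhub-balance z₀∈Z x₂∈V₂) (cong (_+ p') δ⁺z₀≡1)

      V₂-degree : ∀ {v} → part v ≡ false → δ⁺ v ≡ p'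
      V₂-degree {v} v∈V₂ =
        suc-injective (trans (sym (trans (nonhub-balance z₀∈Z v∈V₂) (cong (_+ δ⁺ v) δ⁺z₀≡1))) p≡1+p')

      Z-degree : ∀ {z} → Z z ≡ true → δ⁺ z ≡ 1
      Z-degree {z} z∈Z = +-cancelʳ-≡ p' (δ⁺ z) 1 (trans (sym (nonhub-balance z∈Z x₂∈V₂)) p≡1+p')

      V₁-sum : ∑[ x < n ] (indicator (part x) * degIn G part x) ≡ p * β + q * 1
      V₁-sum = begin
        ∑[ x < n ] (indicator (part x) * degIn G part x)
          ≡⟨ sum-cong-≗ pointwise ⟩
        ∑[ x < n ] (indicator (F x) * β + indicator (Z x) * 1)
          ≡⟨ ∑-distrib-+ (λ x → indicator (F x) * β) (λ x → indicator (Z x) * 1) ⟩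
        ∑[ x < n ] (indicator (F x) * β) + ∑[ x < n ] (indicator (Z x) * 1)
          ≡⟨ cong₂ _+_ (∑-indicator F β) (∑-indicator Z 1) ⟩
        p * β + q * 1
          ∎
        where
        open ≡-Reasoning
        pointwise : ∀ x → indicator (part x) * degIn G part x ≡ indicator (F x) * β + indicator (Z x) * 1
        pointwise x with part x in x∈V | A x x₂ in xx₂
        ... | false | _     = refl
        ... | true  | true  = trans (cong (1 *_) (trans (sym (δ⁺-V₁ x∈V)) (suc-injective (trans (hub-degree x∈F) b≡1+β))))
                                   (sym (+-identityʳ (1 * β)))
          where
          x∈F : F x ≡ true
          x∈F rewrite x∈V | xx₂ = refl
        ... | true  | false = trans (+-identityʳ _) (trans (sym (δ⁺-V₁ x∈V)) (Z-degree x∈Z))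
          where
          x∈Z : Z x ≡ true
          x∈Z rewrite x∈V | xx₂ = refl

      V₂-sum : ∑[ x < n ] (indicator (not (part x)) * degIn G (not ∘ part) x) ≡ b * p'
      V₂-sum = trans (sum-cong-≗ pointwise) (∑-indicator (not ∘ part) p')
        where
        pointwise : ∀ x → indicator (not (part x)) * degIn G (not ∘ part) x ≡ indicator (not (part x)) * p'
        pointwise x with part x in x∈V
        ... | true  = refl
        ... | false = cong (1 *_) (trans (sym (δ⁺-V₂ x∈V)) (V₂-degree x∈V))

      unbalanced-impossible : a ≡ suc b → ⊥
      unbalanced-impossible a≡1+b with k₁ , V₁-even ← degIn-sum-even G part
                                   | k₂ , V₂-even ← degIn-sum-even G (not ∘ part) =
        degree-sums-not-both-even β p' q {k₁} {k₂} q+p'≡1+β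
          (trans (sym V₁-even) (trans V₁-sum (cong (λ t → t * β + q * 1) p≡1+p')))
          (trans (sym V₂-even) (trans V₂-sum (cong (_* p') b≡1+β)))
        where
        q+p'≡1+β : q + p' ≡ suc β
        q+p'≡1+β = suc-injective (begin
          suc (q + p')   ≡⟨ +-suc q p' ⟨
          q + suc p'     ≡⟨ cong (λ t → q + t) p≡1+p' ⟨
          q + p          ≡⟨ +-comm q p ⟩
          p + q          ≡⟨ count-split part (λ u → A u x₂) ⟨
          a              ≡⟨ a≡1+b ⟩
          suc b          ≡⟨ cong suc b≡1+β ⟩
          suc (suc β)    ∎)
          where open ≡-Reasoning

    module TwoNeighbours (δ⁺z₀≡2 : δ⁺ z₀ ≡ 2) where

      hub-degree : ∀ {y} → F y ≡ true → δ⁺ y ≡ b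
      hub-degree y∈F = suc-injective (suc-injective (trans (hub-vs-nonhub y∈F) (cong (_+ b) δ⁺z₀≡2)))

      a≡1+b : a ≡ suc b
      a≡1+b = ≤-antisym (proj₁ equitable) (subst (_< a) (hub-degree y₀∈F) (δ⁺<a (F⇒V₁ y₀∈F)))

      p2Join-case : IsoTo G p2JoinIAdj
      p2Join-case = pairOfHubs (count≡2 p≡2 y₀∈F)
        where
        open FullHubs (λ y∈F → trans (cong suc (hub-degree y∈F)) (sym a≡1+b))
        p≡2 : p ≡ 2
        p≡2 = trans p≡δ⁺z₀ δ⁺z₀≡2
        pairOfHubs : (∃ λ f → f ≢ y₀ × ∀ w → F w ≡ does (w ≟ y₀) ∨ does (w ≟ f)) → IsoTo G p2JoinIAdj
        pairOfHubs (f , f≢y₀ , F≗pair) = p2Join-iso G (f≢y₀ ∘ sym) (hubAdjacency-cong {G = G} F≗pair hubAdjacency)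

    classified : Classified G
    classified = by-δ⁺z₀ (δ⁺ z₀) refl
      where
      by-δ⁺z₀ : ∀ k → δ⁺ z₀ ≡ k → Classified G
      by-δ⁺z₀ 0 δ⁺z₀≡0 = case subst (0 <_) δ⁺z₀≡0 δ⁺z₀>0 of λ ()
      by-δ⁺z₀ 1 δ⁺z₀≡1 with m≤n⇒m<n∨m≡n (proj₁ equitable)
      ... | inj₂ a≡1+b     = ⊥-elim (unbalanced-impossible a≡1+b)
        where open OneNeighbour δ⁺z₀≡1
      ... | inj₁ (s≤s a≤b) = star⇒classified G b (trans n≡a+b (cong (_+ b) a≡b)) (star-case a≡b)
        where
        open OneNeighbour δ⁺z₀≡1
        a≡b : a ≡ b
        a≡b = ≤-antisym a≤b (subst (_≤ a) (hub-degree y₀∈F) (δ⁺<a (F⇒V₁ y₀∈F)))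
      by-δ⁺z₀ 2 δ⁺z₀≡2 = p2Join⇒classified G b (trans n≡a+b (cong (_+ b) a≡1+b)) p2Join-case
        where open TwoNeighbours δ⁺z₀≡2
      by-δ⁺z₀ (suc (suc (suc k))) δ⁺z₀≡3+k = ⊥-elim (<⇒≱ k+b<b (m≤n+m b k))
        where
        δ⁺y₀≡1+k+b : δ⁺ y₀ ≡ suc (k + b)
        δ⁺y₀≡1+k+b = suc-injective (suc-injective (trans (hub-vs-nonhub y₀∈F) (cong (_+ b) δ⁺z₀≡3+k)))
        k+b<b : k + b < b
        k+b<b = subst (_≤ b) δ⁺y₀≡1+k+b (s≤s⁻¹ (≤-trans (δ⁺<a (F⇒V₁ y₀∈F)) (proj₁ equitable)))

  classified : Classified G
  classified with search Z
  ... | inj₂ noZ          = complete⇒classified G (complete-iso G (all-hubs⇒complete noZ))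
  ... | inj₁ (z₀ , z₀∈Z)  = WithNonhub.classified z₀∈Z

classification : ∀ {n} {G : Graph n} {part : Fin n → Bool} → Connected G → Equitable part → Balanced G part →
                 2 ≤ n → Classified G
classification {G = G} {part} connected equitable balanced 2≤n
  with (x₁ , x₁∈V₁) , (x₂ , x₂∈V₂) ← sides-nonempty 2≤n equitable
  with dichotomy {G = G} {part} balanced x₁∈V₁ x₂∈V₂
... | inj₁ homogeneous =
  HomogeneousCase.classified {G = G} {part} connected equitable balanced homogeneous x₁∈V₁ x₂∈V₂
... | inj₂ homogeneous =
  HomogeneousCase.classified {G = G} {not ∘ part} connected
    (equitable-swap {part = part} equitable) (balanced-swap {G = G} balanced) homogeneous
    (cong not x₂∈V₂) (cong not x₁∈V₁)

single-vertex-complete : ∀ {n} (G : Graph n) → n ≤ 1 → ∀ u w → adj G u w ≡ not (does (u ≟ w))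
single-vertex-complete G (s≤s z≤n) zero zero = irref G zero

lemma1 : ∀ (n : ℕ) (G : Graph n) → Connected G →
    (σ : Signature G) (part : Fin n → Bool) →
    IsParityPartition G (proj₁ σ) part →
    DegreeBalanced G (proj₁ σ) part →
    (n % 2 ≡ 0 → IsoTo G starAdj ⊎ IsoTo G completeAdj) ×
    (n % 2 ≡ 1 → IsoTo G p2JoinIAdj ⊎ IsoTo G completeAdj)
lemma1 n G connected (σ , _) part parity degreeBalanced with n ≤? 1
... | yes n≤1 = complete⇒classified G (complete-iso G (single-vertex-complete G n≤1))
... | no  n≰1 = classification {G = G} {part} connected (parity⇒equitable {G = G} {σ} parity)
                  (degreeBalanced⇒balanced {G = G} {σ} parity degreeBalanced) (≰⇒> n≰1)
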